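{- The set of validities (over the class $\mathfrak{M}^\bullet$) of the fragment $\mathcal{L}_{\Diamond_L\langle-\rangle_1}$ is not closed under uniform substitution.
   Context: Fix a countable set $\mathbf{P}$ of atoms. The language $\mathcal{L}$ of SLL is $\varphi::=p\mid\neg\varphi\mid(\varphi\land\varphi)\mid\Diamond_L\varphi\mid\langle-\rangle_1\varphi\mid\langle-\rangle_2\varphi\mid\langle+\rangle\varphi$, where $\Diamond_L$ is the learner-move modality (drawn as a black diamond in the paper) with dual $\Box_L$, and $[-]_1$ is the dual of $\langle-\rangle_1$; $\mathcal{L}_{\Diamond_L\langle-\rangle_1}$ is the fragment whose only modalities are $\Diamond_L$ and $\langle-\rangle_1$. A model is $\mathcal{M}=\langle W,R_1,R_2,V\rangle$ with $W\neq\emptyset$, $R_1,R_2\subseteq W^2$, $V:\mathbf{P}\to2^W$. For a finite non-empty sequence $S=\langle w_0,\dots,w_n\rangle$: $e(S)=w_n$; $Set(S)=\{\langle w_i,w_{i+1}\rangle\mid i<n\}$ ($\emptyset$ if singleton); for $\langle w_i,w_{i+1}\rangle\in Set(S)$, $S|_{\langle w_i,w_{i+1}\rangle}=\langle w_0,\dots,w_u\rangle$ with $u$ the least index such that $\langle w_u,w_{u+1}\rangle=\langle w_i,w_{i+1}\rangle$; $S;v$ is $S$ extended by $v$. A pointed model $\langle\mathcal{M},S\rangle$ requires $Set(S)\subseteq R_1$; $\mathfrak{M}^\bullet$ is the class of pointed models whose sequence is a singleton. $\mathcal{M}\ominus\langle v,v'\rangle$ removes $\langle v,v'\rangle$ from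 $R_1$. Semantics: $\mathcal{M},S\models p$ iff $e(S)\in V(p)$; Booleans as usual; $\Diamond_L\varphi$ iff there is $v$ with $R_1e(S)v$ and $\mathcal{M},S;v\models\varphi$; $\langle-\rangle_1\varphi$ iff there is $\langle v,v'\rangle\in Set(S)\setminus R_2$ with $\mathcal{M}\ominus\langle v,v'\rangle,S|_{\langle v,v'\rangle}\models\varphi$. -}

module Defs where

open import Data.Nat using (ℕ)
open import Data.Product using (Σ; _×_; ∃; ∃-syntax)
open import Relation.Binary.PropositionalEquality using (_≡_)
open import Relation.Nullary using (¬_)

data Form : Set where
  atom   : ℕ → Form
  ¬'_    : Form → Form
  _∧'_   : Form → Form → Form
  ◆L     : Form → Form
  ⟨-⟩₁   : Form → Form

subst : (ℕ → Form) → Form → Form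
subst σ (atom p)  = σ p
subst σ (¬' φ)    = ¬' subst σ φ
subst σ (φ ∧' ψ)  = subst σ φ ∧' subst σ ψ
subst σ (◆L φ)    = ◆L (subst σ φ)
subst σ (⟨-⟩₁ φ)  = ⟨-⟩₁ (subst σ φ)

record Model : Set₁ where
  field
    W  : Set
    R₁ : W → W → Set
    R₂ : W → W → Set
    V  : ℕ → W → Set

data Seq (W : Set) : Set where
  [_] : W → Seq W
  _▸_ : Seq W → W → Seq W

module _ {W : Set} where
  e : Seq W → W
  e [ w ]   = w
  e (S ▸ v) = v

  data InSet : Seq W → W → W → Set where
    here  : ∀ {S x} → InSet (S ▸ x) (e S) x
    there : ∀ {S x v v'} → InSet S v v' → InSet (S ▸ x) v v'

  -- Restr S v v' T  :  T = S|⟨v,v'⟩  (prefix ending at the FIRST occurrence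
  -- of the pair ⟨v,v'⟩ in S; only defined when ⟨v,v'⟩ ∈ Set(S)).
  data Restr : Seq W → W → W → Seq W → Set where
    now   : ∀ {S x} → ¬ InSet S (e S) x → Restr (S ▸ x) (e S) x S
    later : ∀ {S x v v' T} → Restr S v v' T → Restr (S ▸ x) v v' T

_⊖_ : (M : Model) → Model.W M × Model.W M → Model
M ⊖ (v Data.Product., v') = record
  { W  = W
  ; R₁ = λ x y → R₁ x y × ¬ ((x ≡ v) × (y ≡ v'))
  ; R₂ = R₂
  ; V  = V }
  where open Model M

_,_⊨_ : (M : Model) → Seq (Model.W M) → Form → Set
M , S ⊨ atom p   = Model.V M p (e S)
M , S ⊨ (¬' φ)   = ¬ (M , S ⊨ φ)
M , S ⊨ (φ ∧' ψ) = (M , S ⊨ φ) × (M , S ⊨ ψ)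
M , S ⊨ ◆L φ     = ∃[ v ] (Model.R₁ M (e S) v × (M , (S ▸ v) ⊨ φ))
M , S ⊨ ⟨-⟩₁ φ   = ∃[ v ] ∃[ v' ] ∃[ T ]
                     (Restr S v v' T × ¬ Model.R₂ M v v'
                      × ((M ⊖ (v Data.Product., v')) , T ⊨ φ))

-- Validity over 𝔐• (pointed models whose sequence is a singleton)
Valid• : Form → Set₁
Valid• φ = (M : Model) (w : Model.W M) → M , [ w ] ⊨ φ

-- From a singleton ⟨w⟩, a learner move to v followed by a deletion can only
-- delete ⟨w,v⟩ and return to ⟨w⟩; so ◆L ⟨-⟩₁ p → p is valid on 𝔐•, since
-- deleting an R₁-edge does not change valuations. Substituting for p the
-- dead-end formula ¬ ◆L ⊤, which is sensitive to the deleted edge, refutes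
-- the instance on the one-point model with a loop.
module Submission where

open import Defs
open import Data.Nat using (ℕ)
open import Data.Product using (Σ; _×_; _,_; proj₂; ∃-syntax)
open import Data.Unit using (⊤; tt)
open import Data.Empty using (⊥)
open import Relation.Nullary using (¬_)
open import Relation.Binary.PropositionalEquality using (refl)

infixr 4 _⇒'_

_⇒'_ : Form → Form → Form
φ ⇒' ψ = ¬' (φ ∧' (¬' ψ))

⊤' : Form
⊤' = ¬' (atom 0 ∧' (¬' atom 0))

⇒'-intro : ∀ M S φ ψ → (M , S ⊨ φ → M , S ⊨ ψ) → M , S ⊨ (φ ⇒' ψ)
⇒'-intro M S φ ψ f (sφ , ¬sψ) = ¬sψ (f sφ)

⊤'-true : ∀ M S → M , S ⊨ ⊤'
⊤'-true M S (sp , ¬sp) = ¬sp sp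

◆L⟨-⟩₁-singleton : ∀ M w φ → M , [ w ] ⊨ ◆L (⟨-⟩₁ φ) →
                   ∃[ v ] ((M ⊖ (w , v)) , [ w ] ⊨ φ)
◆L⟨-⟩₁-singleton M w φ (v , _ , (_ , _ , _ , now _ , _ , sφ)) = v , sφ
◆L⟨-⟩₁-singleton M w φ (v , _ , (_ , _ , _ , later () , _ , _))

◆L⟨-⟩₁-atom-⇒-atom : ∀ M w p → M , [ w ] ⊨ (◆L (⟨-⟩₁ (atom p)) ⇒' atom p)
◆L⟨-⟩₁-atom-⇒-atom M w p =
  ⇒'-intro M [ w ] (◆L (⟨-⟩₁ (atom p))) (atom p)
    λ s → proj₂ (◆L⟨-⟩₁-singleton M w (atom p) s)

loop : Model
loop = record { W = ⊤ ; R₁ = λ _ _ → ⊤ ; R₂ = λ _ _ → ⊥ ; V = λ _ _ → ⊤ }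

loop-dead-end-after-deletion : ∀ S φ → (loop ⊖ (tt , tt)) , S ⊨ (¬' ◆L φ)
loop-dead-end-after-deletion S φ (_ , (_ , not-deleted) , _) = not-deleted (refl , refl)

loop-delete-to-dead-end : loop , [ tt ] ⊨ ◆L (⟨-⟩₁ (¬' ◆L ⊤'))
loop-delete-to-dead-end =
  tt , tt , (tt , tt , [ tt ] , now (λ ()) , (λ ()) , loop-dead-end-after-deletion [ tt ] ⊤')

loop-not-dead-end : loop , [ tt ] ⊨ ◆L ⊤'
loop-not-dead-end = tt , tt , ⊤'-true loop ([ tt ] ▸ tt)

proposition5 : Σ Form (λ φ → Σ (ℕ → Form) (λ σ → Valid• φ × ¬ Valid• (subst σ φ)))
proposition5 =
  (◆L (⟨-⟩₁ (atom 0)) ⇒' atom 0) , (λ _ → ¬' ◆L ⊤') ,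
  (λ M w → ◆L⟨-⟩₁-atom-⇒-atom M w 0) ,
  λ valid → valid loop tt (loop-delete-to-dead-end , λ dead-end → dead-end loop-not-dead-end)
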